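{- For every odd integer $n\ge 3$ and every positive divisor $\lambda$ of $2n$ there exists a ${}^{\lambda}\mathrm{H}_{2n/\lambda}(n;3)$.
   Context: A partially filled (p.f.) array is a matrix in which some cells may be empty. For positive integers $\lambda,\tau$ with $\tau$ dividing $\frac{6n}{\lambda}$, put $w=\frac{6n}{\lambda}+\tau$ and let $J$ be the subgroup of $\mathbb{Z}_w$ of order $\tau$. ${}^{\lambda}\mathrm{H}_\tau(n;3)$ denotes an $n\times n$ p.f. array with entries in $\mathbb{Z}_w$ such that: (a) each row and each column has exactly $3$ filled cells; (b) the multiset $\{\pm x : x \text{ an entry of a filled cell}\}$ (with multiplicity) contains each element of $\mathbb{Z}_w\setminus J$ exactly $\lambda$ times; (c) every row and column sums to $0$ in $\mathbb{Z}_w$. -}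

module Defs where

open import Data.Nat using (ℕ; zero; suc; _+_; _*_; NonZero)
open import Data.Nat.DivMod using (_/_)
open import Data.Nat.Divisibility using (_∣_)
open import Data.Fin using (Fin; toℕ)
open import Data.Fin.Properties using (_≟_)
open import Data.Maybe using (Maybe; just; nothing)
open import Data.Product using (Σ; _×_)
open import Relation.Binary.PropositionalEquality using (_≡_)
open import Relation.Nullary using (¬_; yes; no)
open import Relation.Nullary.Decidable using (⌊_⌋)
open import Data.Nat.Divisibility using (_∣?_)

Σ-Fin : (m : ℕ) → (Fin m → ℕ) → ℕ
Σ-Fin zero    f = 0
Σ-Fin (suc m) f = f Fin.zero + Σ-Fin m (λ i → f (Fin.suc i))
  where import Data.Fin as Fin

-- A p.f. array of size n × n with entries in ℤ_w (represented by Fin w):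
-- a cell is either empty (nothing) or filled (just x).
PFArray : ℕ → ℕ → Set
PFArray n w = Fin n → Fin n → Maybe (Fin w)

filled : ∀ {w} → Maybe (Fin w) → ℕ
filled (just _) = 1
filled nothing  = 0

val : ∀ {w} → Maybe (Fin w) → ℕ
val (just x) = toℕ x
val nothing  = 0

-- number of occurrences of y in the multiset {x, -x} (computed in ℤ_w)
-- contributed by a cell: [x = y] + [-x = y], where -x = y in ℤ_w iff w ∣ x + y.
occ : ∀ {w} → Fin w → Maybe (Fin w) → ℕ
occ y nothing  = 0
occ {w} y (just x) =
  (if ⌊ x ≟ y ⌋ then 1 else 0) + (if ⌊ w ∣? (toℕ x + toℕ y) ⌋ then 1 else 0)
  where open import Data.Bool using (if_then_else_)

-- Membership in J, the subgroup of ℤ_w of order τ (τ ∣ w):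
-- J = { x ∈ ℤ_w : τ·x = 0 in ℤ_w } = the multiples of w/τ.
InJ : (w τ : ℕ) → Fin w → Set
InJ w τ x = w ∣ τ * toℕ x

record IsH (lam τ n k w : ℕ) (A : PFArray n w) : Set where
  field
    rowFilled : ∀ i → Σ-Fin n (λ j → filled (A i j)) ≡ k
    colFilled : ∀ j → Σ-Fin n (λ i → filled (A i j)) ≡ k
    outsideJ  : ∀ (y : Fin w) → ¬ InJ w τ y →
                Σ-Fin n (λ i → Σ-Fin n (λ j → occ y (A i j))) ≡ lam
    insideJ   : ∀ (y : Fin w) → InJ w τ y →
                Σ-Fin n (λ i → Σ-Fin n (λ j → occ y (A i j))) ≡ 0
    rowSum    : ∀ i → w ∣ Σ-Fin n (λ j → val (A i j))
    colSum    : ∀ j → w ∣ Σ-Fin n (λ i → val (A i j))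

wOf : (lam τ n : ℕ) .{{_ : NonZero lam}} → ℕ
wOf lam τ n = (6 * n) / lam + τ

HExists : (lam τ n k : ℕ) .{{_ : NonZero lam}} → Set
HExists lam τ n k = Σ (PFArray n (wOf lam τ n)) (IsH lam τ n k (wOf lam τ n))

-- Row i of the n × n array carries 1 + 8i, 10 + 16(n − 1 − i) and 5 + 8i (mod w = 4τ) in the cyclically
-- consecutive columns i, i + 1, i + 2. Every row sums to 16n and every column to a multiple of 8n = λw.
-- The entries 1 + 8i and 5 + 8i are the numbers 1 + 4t, t < 2n = λτ, which meet every class ≡ 1 (mod 4)
-- of ℤ_w exactly λ times, so ±x meets every odd class λ times. The entries 10 + 16k, k < n, are ≡ 2
-- (mod 4): for λ = 2l (τ odd, 4 invertible mod τ) they meet each such class l times, so ±x meets it 2l = λ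
-- times; for odd λ (τ = 2p, p odd, 2 invertible mod p) they meet exactly one of y and −y, λ times. The
-- multiples of 4, which form J, are never met. Each of these counts is the number of solutions t < m of
-- c t + s ≡ 0 (mod m) for a unit c, repeated periodically.

module Submission where

open import Defs

open import Data.Bool using (if_then_else_)
open import Data.Fin using (Fin; toℕ)
open import Data.Fin.Properties using (toℕ<n; toℕ-injective; toℕ-fromℕ<) renaming (_≟_ to _≟ᶠ_)
open import Data.Maybe using (Maybe; just; nothing)
open import Data.Empty using (⊥-elim)
open import Data.Nat
open import Data.Nat.Divisibility
open import Data.Nat.DivMod
open import Data.Nat.Properties
open import Data.Nat.Tactic.RingSolver using (solve-∀)
open import Algebra.Properties.CommutativeSemigroup *-commutativeSemigroup using (x∙yz≈y∙xz)
open import Data.Product using (Σ; ∃; _,_; _×_)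
open import Data.Sum using (_⊎_; inj₁; inj₂)
open import Function.Bundles using (_⇔_; mk⇔; Equivalence)
open import Function.Construct.Composition using (_⇔-∘_)
open import Function.Construct.Identity using (⇔-id)
open import Relation.Binary.PropositionalEquality hiding ([_])
open import Relation.Nullary using (Dec; yes; no; ¬_; contradiction)
open import Relation.Nullary.Decidable using (⌊_⌋)

open Equivalence using (to; from)

χ : ∀ {p} {P : Set p} → Dec P → ℕ
χ d = if ⌊ d ⌋ then 1 else 0

χ-yes : ∀ {p} {P : Set p} (d : Dec P) → P → χ d ≡ 1
χ-yes (yes _) _ = refl
χ-yes (no ¬p) p = ⊥-elim (¬p p)

χ-no : ∀ {p} {P : Set p} (d : Dec P) → ¬ P → χ d ≡ 0
χ-no (yes p) ¬p = ⊥-elim (¬p p)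
χ-no (no _)  _  = refl

χ-cong : ∀ {p q} {P : Set p} {Q : Set q} → P ⇔ Q → (d : Dec P) (e : Dec Q) → χ d ≡ χ e
χ-cong P⇔Q (yes p) e = sym (χ-yes e (to P⇔Q p))
χ-cong P⇔Q (no ¬p) e = sym (χ-no e (λ q → ¬p (from P⇔Q q)))

-- Finite sums

sum : ℕ → (ℕ → ℕ) → ℕ
sum zero    f = 0
sum (suc n) f = f 0 + sum n (λ i → f (suc i))

syntax sum n (λ i → e) = ∑[ i < n ] e

sum-cong : ∀ n {f g : ℕ → ℕ} → (∀ i → i < n → f i ≡ g i) → sum n f ≡ sum n g
sum-cong zero    f≡g = refl
sum-cong (suc n) f≡g = cong₂ _+_ (f≡g 0 z<s) (sum-cong n (λ i i<n → f≡g (suc i) (s<s i<n)))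

sum-zero : ∀ n {f : ℕ → ℕ} → (∀ i → i < n → f i ≡ 0) → sum n f ≡ 0
sum-zero zero    f≡0 = refl
sum-zero (suc n) f≡0 rewrite f≡0 0 z<s = sum-zero n (λ i i<n → f≡0 (suc i) (s<s i<n))

sum-distrib-+ : ∀ n (f g : ℕ → ℕ) → ∑[ i < n ] (f i + g i) ≡ sum n f + sum n g
sum-distrib-+ zero    f g = refl
sum-distrib-+ (suc n) f g =
  trans (cong (f 0 + g 0 +_) (sum-distrib-+ n (λ i → f (suc i)) (λ i → g (suc i))))
        (+-+-interchange (f 0) (g 0) _ _)
  where
  +-+-interchange : ∀ a b c d → a + b + (c + d) ≡ a + c + (b + d)
  +-+-interchange = solve-∀

sum-+ : ∀ m k (f : ℕ → ℕ) → sum (m + k) f ≡ sum m f + ∑[ i < k ] f (m + i)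
sum-+ zero    k f = refl
sum-+ (suc m) k f = trans (cong (f 0 +_) (sum-+ m k (λ i → f (suc i)))) (sym (+-assoc (f 0) _ _))

sum-periodic : ∀ r p (f : ℕ → ℕ) → (∀ i → f (p + i) ≡ f i) → sum (r * p) f ≡ r * sum p f
sum-periodic zero    p f periodic = refl
sum-periodic (suc r) p f periodic = begin
  sum (p + r * p) f                  ≡⟨ sum-+ p (r * p) f ⟩
  sum p f + ∑[ i < r * p ] f (p + i) ≡⟨ cong (sum p f +_) (sum-cong (r * p) (λ i _ → periodic i)) ⟩
  sum p f + sum (r * p) f            ≡⟨ cong (sum p f +_) (sum-periodic r p f periodic) ⟩
  sum p f + r * sum p f              ∎
  where open ≡-Reasoning

sum-suc : ∀ n (f : ℕ → ℕ) → sum (suc n) f ≡ sum n f + f n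
sum-suc zero    f = +-identityʳ (f 0)
sum-suc (suc n) f = trans (cong (f 0 +_) (sum-suc n (λ i → f (suc i)))) (sym (+-assoc (f 0) _ _))

sum-reverse : ∀ n (f : ℕ → ℕ) → ∑[ i < n ] f (n ∸ suc i) ≡ sum n f
sum-reverse zero    f = refl
sum-reverse (suc n) f = begin
  f n + ∑[ i < n ] f (n ∸ suc i) ≡⟨ cong (f n +_) (sum-reverse n f) ⟩
  f n + sum n f                  ≡⟨ +-comm (f n) (sum n f) ⟩
  sum n f + f n                  ≡⟨ sum-suc n f ⟨
  sum (suc n) f                  ∎
  where open ≡-Reasoning

sum-interleave : ∀ n (f : ℕ → ℕ) → ∑[ i < n ] (f (2 * i) + f (1 + 2 * i)) ≡ sum (2 * n) f
sum-interleave zero    f = refl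
sum-interleave (suc n) f = begin
  f 0 + f 1 + ∑[ i < n ] (f (2 * suc i) + f (1 + 2 * suc i))
    ≡⟨ cong (f 0 + f 1 +_) (sum-cong n (λ i _ → cong₂ _+_ (cong f (*-suc 2 i)) (cong (λ k → f (1 + k)) (*-suc 2 i)))) ⟩
  f 0 + f 1 + ∑[ i < n ] (f (2 + 2 * i) + f (3 + 2 * i))
    ≡⟨ cong (f 0 + f 1 +_) (sum-interleave n (λ i → f (2 + i))) ⟩
  f 0 + f 1 + ∑[ i < 2 * n ] f (2 + i)
    ≡⟨ +-assoc (f 0) (f 1) _ ⟩
  sum (2 + 2 * n) f
    ≡⟨ cong (λ k → sum k f) (*-suc 2 n) ⟨
  sum (2 * suc n) f ∎
  where open ≡-Reasoning

sum-select : ∀ n {P : ℕ → Set} (P? : ∀ i → Dec (P i)) (F : ℕ → ℕ) {a} → a < n →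
             (∀ i → i < n → P i ⇔ i ≡ a) → ∑[ i < n ] (χ (P? i) * F i) ≡ F a
sum-select (suc n) P? F {zero} _ P⇔≡a = begin
  χ (P? 0) * F 0 + ∑[ i < n ] (χ (P? (suc i)) * F (suc i))
    ≡⟨ cong₂ _+_ (cong (_* F 0) (χ-yes (P? 0) (from (P⇔≡a 0 z<s) refl)))
                 (sum-zero n (λ i i<n → cong (_* F (suc i))
                   (χ-no (P? (suc i)) (λ p → 0≢1+n (sym (to (P⇔≡a (suc i) (s<s i<n)) p)))))) ⟩
  1 * F 0 + 0
    ≡⟨ +-identityʳ _ ⟩
  1 * F 0
    ≡⟨ *-identityˡ (F 0) ⟩
  F 0 ∎
  where open ≡-Reasoning
sum-select (suc n) P? F {suc a} (s<s a<n) P⇔≡a = begin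
  χ (P? 0) * F 0 + ∑[ i < n ] (χ (P? (suc i)) * F (suc i))
    ≡⟨ cong (λ k → k * F 0 + ∑[ i < n ] (χ (P? (suc i)) * F (suc i))) (χ-no (P? 0) (λ p → 0≢1+n (to (P⇔≡a 0 z<s) p))) ⟩
  ∑[ i < n ] (χ (P? (suc i)) * F (suc i))
    ≡⟨ sum-select n (λ i → P? (suc i)) (λ i → F (suc i)) a<n
         (λ i i<n → mk⇔ (λ p → suc-injective (to (P⇔≡a (suc i) (s<s i<n)) p))
                        (λ i≡a → from (P⇔≡a (suc i) (s<s i<n)) (cong suc i≡a))) ⟩
  F (suc a) ∎
  where open ≡-Reasoning

sum-unique : ∀ n {P : ℕ → Set} (P? : ∀ i → Dec (P i)) {a} → a < n →
             (∀ i → i < n → P i ⇔ i ≡ a) → ∑[ i < n ] χ (P? i) ≡ 1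
sum-unique n P? a<n P⇔≡a =
  trans (sum-cong n (λ i _ → sym (*-identityʳ (χ (P? i))))) (sum-select n P? (λ _ → 1) a<n P⇔≡a)

Σ-Fin-toℕ : ∀ m (f : ℕ → ℕ) → Σ-Fin m (λ i → f (toℕ i)) ≡ sum m f
Σ-Fin-toℕ zero    f = refl
Σ-Fin-toℕ (suc m) f = cong (f 0 +_) (Σ-Fin-toℕ m (λ i → f (suc i)))

Σ-Fin²-toℕ : ∀ m (f : ℕ → ℕ → ℕ) → Σ-Fin m (λ i → Σ-Fin m (λ j → f (toℕ i) (toℕ j))) ≡ ∑[ i < m ] sum m (f i)
Σ-Fin²-toℕ m f = trans (Σ-Fin-toℕ m (λ i → Σ-Fin m (λ j → f i (toℕ j)))) (sum-cong m (λ i _ → Σ-Fin-toℕ m (f i)))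

-- Linear congruences

-- c · u ≡ −1 (mod m), phrased without subtraction; it makes c a unit modulo m.
record UnitMod (m c : ℕ) : Set where
  constructor mkUnitMod
  field
    u      : ℕ
    m∣cu+1 : m ∣ c * u + 1

1-unitMod : ∀ m .{{_ : NonZero m}} → UnitMod m 1
1-unitMod (suc m) = mkUnitMod m (subst (suc m ∣_) (lemma m) ∣-refl)
  where
  lemma : ∀ m → suc m ≡ 1 * m + 1
  lemma = solve-∀

2-unitMod : ∀ q → UnitMod (1 + 2 * q) 2
2-unitMod q = mkUnitMod q (subst (1 + 2 * q ∣_) (+-comm 1 (2 * q)) ∣-refl)

-- 4 · q(q+1) + 1 = (2q+1)².
4-unitMod : ∀ q → UnitMod (1 + 2 * q) 4
4-unitMod q = mkUnitMod (q * (1 + q)) (subst (1 + 2 * q ∣_) (lemma q) (m∣m*n (1 + 2 * q)))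
  where
  lemma : ∀ q → (1 + 2 * q) * (1 + 2 * q) ≡ 4 * (q * (1 + q)) + 1
  lemma = solve-∀

unitMod-cancel : ∀ {m c x} → UnitMod m c → m ∣ c * x → m ∣ x
unitMod-cancel {m} {c} {x} (mkUnitMod u m∣cu+1) m∣cx =
  ∣m+n∣m⇒∣n (subst (m ∣_) (lemma c u x) (∣m⇒∣m*n x m∣cu+1)) (∣n⇒∣m*n u m∣cx)
  where
  lemma : ∀ c u x → (c * u + 1) * x ≡ u * (c * x) + x
  lemma = solve-∀

∣∧<⇒≡0 : ∀ {m x} → m ∣ x → x < m → x ≡ 0
∣∧<⇒≡0 {x = zero}  _   _   = refl
∣∧<⇒≡0 {x = suc x} m∣x x<m = contradiction m∣x (>⇒∤ x<m)

solution-unique-≤ : ∀ {m c s a b} → UnitMod m c → a ≤ b → b < m →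
                    m ∣ c * a + s → m ∣ c * b + s → b ≡ a
solution-unique-≤ {m} {c} {s} {a} {b} unit a≤b b<m m∣a m∣b =
  ≤-antisym (m∸n≡0⇒m≤n b∸a≡0) a≤b
  where
  split : c * b + s ≡ (c * a + s) + c * (b ∸ a)
  split = begin
    c * b + s               ≡⟨ cong (λ k → c * k + s) (m+[n∸m]≡n a≤b) ⟨
    c * (a + (b ∸ a)) + s   ≡⟨ lemma c a (b ∸ a) s ⟩
    (c * a + s) + c * (b ∸ a) ∎
    where
    open ≡-Reasoning
    lemma : ∀ c a d s → c * (a + d) + s ≡ (c * a + s) + c * d
    lemma = solve-∀
  b∸a≡0 : b ∸ a ≡ 0
  b∸a≡0 = ∣∧<⇒≡0 (unitMod-cancel unit (∣m+n∣m⇒∣n (subst (m ∣_) split m∣b) m∣a))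
                       (≤-<-trans (m∸n≤m b a) b<m)

solution-unique : ∀ {m c s a b} → UnitMod m c → a < m → b < m →
                  m ∣ c * a + s → m ∣ c * b + s → a ≡ b
solution-unique {a = a} {b} unit a<m b<m m∣a m∣b with ≤-total a b
... | inj₁ a≤b = sym (solution-unique-≤ unit a≤b b<m m∣a m∣b)
... | inj₂ b≤a = solution-unique-≤ unit b≤a a<m m∣b m∣a

-- t = u s works since c (u s) + s = s (c u + 1).
solution-exists : ∀ m .{{_ : NonZero m}} {c} s → UnitMod m c → ∃ λ t → t < m × m ∣ c * t + s
solution-exists m {c} s (mkUnitMod u m∣cu+1) = u * s % m , m%n<n (u * s) m , m∣c[us%m]+s
  where
  split : (c * (u * s / m)) * m + (c * (u * s % m) + s) ≡ s * (c * u + 1)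
  split = begin
    (c * (u * s / m)) * m + (c * (u * s % m) + s) ≡⟨ lemma c (u * s % m) (u * s / m) m s ⟩
    c * (u * s % m + u * s / m * m) + s          ≡⟨ cong (λ k → c * k + s) (m≡m%n+[m/n]*n (u * s) m) ⟨
    c * (u * s) + s                              ≡⟨ lemma′ c u s ⟩
    s * (c * u + 1)                              ∎
    where
    open ≡-Reasoning
    lemma : ∀ c r q m s → (c * q) * m + (c * r + s) ≡ c * (r + q * m) + s
    lemma = solve-∀
    lemma′ : ∀ c u s → c * (u * s) + s ≡ s * (c * u + 1)
    lemma′ = solve-∀
  m∣c[us%m]+s : m ∣ c * (u * s % m) + s
  m∣c[us%m]+s = ∣m+n∣m⇒∣n (subst (m ∣_) (sym split) (∣n⇒∣m*n s m∣cu+1)) (n∣m*n (c * (u * s / m)))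

count-solutions : ∀ m .{{_ : NonZero m}} {c} s → UnitMod m c → ∑[ t < m ] χ (m ∣? c * t + s) ≡ 1
count-solutions m s unit with solution-exists m s unit
... | t , t<m , m∣t = sum-unique m (λ i → m ∣? _) t<m
        (λ i i<m → mk⇔ (λ m∣i → solution-unique unit i<m t<m m∣i m∣t) (λ { refl → m∣t }))

∣-sum-of-residues : ∀ d .{{_ : NonZero d}} x y z → d ∣ x + y + z → d ∣ x % d + y % d + z % d
∣-sum-of-residues d x y z d∣x+y+z = ∣m+n∣m⇒∣n (subst (d ∣_) split d∣x+y+z) (n∣m*n (x / d + y / d + z / d))
  where
  split : x + y + z ≡ (x / d + y / d + z / d) * d + (x % d + y % d + z % d)
  split = trans (cong₂ _+_ (cong₂ _+_ (m≡m%n+[m/n]*n x d) (m≡m%n+[m/n]*n y d)) (m≡m%n+[m/n]*n z d))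
                (lemma (x % d) (y % d) (z % d) (x / d) (y / d) (z / d) d)
    where
    lemma : ∀ r s t a b c d → r + a * d + (s + b * d) + (t + c * d) ≡ (a + b + c) * d + (r + s + t)
    lemma = solve-∀

-- Both r and s solve t + (m ∸ s) ≡ 0 (mod m).
≡⇔∣+∸ : ∀ {m r s} .{{_ : NonZero m}} → r < m → s < m → r ≡ s ⇔ m ∣ r + (m ∸ s)
≡⇔∣+∸ {m} {r} {s} r<m s<m = mk⇔ (λ { refl → m∣s+[m∸s] }) (λ m∣r+[m∸s] →
  solution-unique (1-unitMod m) r<m s<m (subst (λ k → m ∣ k + (m ∸ s)) (sym (*-identityˡ r)) m∣r+[m∸s])
                                        (subst (λ k → m ∣ k + (m ∸ s)) (sym (*-identityˡ s)) m∣s+[m∸s]))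
  where
  m∣s+[m∸s] : m ∣ s + (m ∸ s)
  m∣s+[m∸s] = subst (m ∣_) (sym (m+[n∸m]≡n (<⇒≤ s<m))) ∣-refl

[_∣_] : ℕ → ℕ → ℕ
[ d ∣ x ] = χ (d ∣? x)

[∣]-shift : ∀ d k x → [ d ∣ d * k + x ] ≡ [ d ∣ x ]
[∣]-shift d k x = χ-cong (mk⇔ (λ d∣dk+x → ∣m+n∣m⇒∣n d∣dk+x (m∣m*n k)) (∣m∣n⇒∣m+n (m∣m*n k))) _ _

[∣]-complement : ∀ {d a b} → d ∣ a + b → [ d ∣ a ] ≡ [ d ∣ b ]
[∣]-complement {d} {a} {b} d∣a+b = χ-cong
  (mk⇔ (∣m+n∣m⇒∣n d∣a+b) (∣m+n∣m⇒∣n (subst (d ∣_) (+-comm a b) d∣a+b))) _ _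

[∣]-mod : ∀ d .{{_ : NonZero d}} x z → [ d ∣ x % d + z ] ≡ [ d ∣ x + z ]
[∣]-mod d x z = trans (sym ([∣]-shift d (x / d) (x % d + z))) (cong [ d ∣_] split)
  where
  split : d * (x / d) + (x % d + z) ≡ x + z
  split = trans (lemma d (x / d) (x % d) z) (cong (_+ z) (sym (m≡m%n+[m/n]*n x d)))
    where
    lemma : ∀ d q r z → d * q + (r + z) ≡ r + q * d + z
    lemma = solve-∀

count-multiples : ∀ r d m {c} z .{{_ : NonZero d}} .{{_ : NonZero m}} → UnitMod m c →
                  ∑[ t < r * m ] [ d * m ∣ d * (c * t) + z ] ≡ r * [ d ∣ z ]
count-multiples r d m {c} z unit = begin
  ∑[ t < r * m ] [ d * m ∣ d * (c * t) + z ] ≡⟨ sum-periodic r m _ periodic ⟩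
  r * ∑[ t < m ] [ d * m ∣ d * (c * t) + z ] ≡⟨ cong (r *_) one-period ⟩
  r * [ d ∣ z ]                              ∎
  where
  open ≡-Reasoning
  periodic : ∀ t → [ d * m ∣ d * (c * (m + t)) + z ] ≡ [ d * m ∣ d * (c * t) + z ]
  periodic t = trans (cong [ d * m ∣_] (lemma d c m t z)) ([∣]-shift (d * m) c _)
    where
    lemma : ∀ d c m t z → d * (c * (m + t)) + z ≡ d * m * c + (d * (c * t) + z)
    lemma = solve-∀
  one-period : ∑[ t < m ] [ d * m ∣ d * (c * t) + z ] ≡ [ d ∣ z ]
  one-period with d ∣? z
  ... | yes (divides e refl) = trans (sum-cong m (λ t _ → cancel-d t)) (count-solutions m e unit)
    where
    cancel-d : ∀ t → [ d * m ∣ d * (c * t) + e * d ] ≡ χ (m ∣? c * t + e)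
    cancel-d t = trans (cong [ d * m ∣_] (lemma d c t e))
                       (χ-cong (mk⇔ (*-cancelˡ-∣ d) (*-monoʳ-∣ d)) _ _)
      where
      lemma : ∀ d c t e → d * (c * t) + e * d ≡ d * (c * t + e)
      lemma = solve-∀
  ... | no d∤z = sum-zero m (λ t _ → χ-no _ (λ dm∣dct+z →
                   d∤z (∣m+n∣m⇒∣n (∣-trans (m∣m*n m) dm∣dct+z) (m∣m*n (c * t)))))

one-of-four-consecutive : ∀ y → [ 4 ∣ y ] + ([ 4 ∣ 1 + y ] + [ 4 ∣ 2 + y ] + [ 4 ∣ 3 + y ]) ≡ 1
one-of-four-consecutive y = trans (lemma [ 4 ∣ y ] [ 4 ∣ 1 + y ] [ 4 ∣ 2 + y ] [ 4 ∣ 3 + y ])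
                                  (count-solutions 4 y (1-unitMod 4))
  where
  lemma : ∀ a b c d → a + (b + c + d) ≡ a + (b + (c + (d + 0)))
  lemma = solve-∀

nonzero-residues-of-multiple : ∀ {y} → 4 ∣ y → [ 4 ∣ 1 + y ] + [ 4 ∣ 2 + y ] + [ 4 ∣ 3 + y ] ≡ 0
nonzero-residues-of-multiple {y} 4∣y =
  suc-injective (trans (cong (_+ rest) (sym (χ-yes (4 ∣? y) 4∣y))) (one-of-four-consecutive y))
  where
  rest : ℕ
  rest = [ 4 ∣ 1 + y ] + [ 4 ∣ 2 + y ] + [ 4 ∣ 3 + y ]

nonzero-residues-of-non-multiple : ∀ {y} → ¬ 4 ∣ y → [ 4 ∣ 1 + y ] + [ 4 ∣ 2 + y ] + [ 4 ∣ 3 + y ] ≡ 1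
nonzero-residues-of-non-multiple {y} 4∤y =
  trans (cong (_+ rest) (sym (χ-no (4 ∣? y) 4∤y))) (one-of-four-consecutive y)
  where
  rest : ℕ
  rest = [ 4 ∣ 1 + y ] + [ 4 ∣ 2 + y ] + [ 4 ∣ 3 + y ]

[8∣]-split : ∀ a → [ 8 ∣ a ] + [ 8 ∣ 4 + a ] ≡ [ 4 ∣ a ]
[8∣]-split a = trans (cong ([ 8 ∣ a ] +_) (sym (+-identityʳ _)))
                     (trans (count-multiples 1 4 2 a (1-unitMod 2)) (+-identityʳ _))

halve : ∀ {x y} → 2 * x ≡ 2 * y → x ≡ y
halve = *-cancelˡ-≡ _ _ 2

even-or-odd : ∀ m → (∃ λ h → m ≡ 2 * h) ⊎ (∃ λ h → m ≡ 1 + 2 * h)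
even-or-odd zero    = inj₁ (0 , refl)
even-or-odd (suc m) with even-or-odd m
... | inj₁ (h , refl) = inj₂ (h , refl)
... | inj₂ (h , refl) = inj₁ (suc h , sym (*-suc 2 h))

-- Since n is odd, exactly one of λ and τ carries the factor 2 of λ τ = 2n.
data Factorisation (n lam τ : ℕ) : Set where
  lam-even : ∀ l q → lam ≡ 2 * l → τ ≡ 1 + 2 * q → n ≡ l * τ → Factorisation n lam τ
  lam-odd  : ∀ p q → τ ≡ 2 * p → p ≡ 1 + 2 * q → n ≡ lam * p → Factorisation n lam τ

odd⇒≢2* : ∀ {n k} → n ≡ 2 * k + 1 → ∀ x → n ≢ 2 * x
odd⇒≢2* {k = k} n≡2k+1 x n≡2x = even≢odd x k (trans (sym n≡2x) (trans n≡2k+1 (+-comm (2 * k) 1)))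

factorisation : ∀ {n lam τ k} → n ≡ 2 * k + 1 → lam * τ ≡ 2 * n → Factorisation n lam τ
factorisation {n} {lam} {τ} {k} n≡2k+1 lamτ≡2n with even-or-odd lam | even-or-odd τ
... | inj₁ (l , refl) | inj₁ (g , refl) =
  ⊥-elim (odd⇒≢2* {k = k} n≡2k+1 (l * g)
    (trans (halve (trans (sym lamτ≡2n) (*-assoc 2 l (2 * g)))) (x∙yz≈y∙xz l 2 g)))
... | inj₁ (l , refl) | inj₂ (q , refl) = lam-even l q refl refl (halve (trans (sym lamτ≡2n) (*-assoc 2 l τ)))
... | inj₂ (l , refl) | inj₂ (g , refl) = ⊥-elim (even≢odd n (2 * l * g + l + g) (trans (sym lamτ≡2n) (lemma l g)))
  where
  lemma : ∀ l g → (1 + 2 * l) * (1 + 2 * g) ≡ suc (2 * (2 * l * g + l + g))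
  lemma = solve-∀
... | inj₂ _ | inj₁ (p , refl) = p-odd (halve (trans (sym lamτ≡2n) (x∙yz≈y∙xz lam 2 p)))
  where
  p-odd : n ≡ lam * p → Factorisation n lam (2 * p)
  p-odd n≡lam*p with even-or-odd p
  ... | inj₁ (g , refl) = ⊥-elim (odd⇒≢2* {k = k} n≡2k+1 (lam * g) (trans n≡lam*p (x∙yz≈y∙xz lam 2 g)))
  ... | inj₂ (q , refl) = lam-odd _ q refl refl n≡lam*p

-- The cyclic array

module Cycle (n : ℕ) (3≤n : 3 ≤ n) where

  next : ℕ → ℕ
  next i with suc i ≟ n
  ... | yes _ = 0
  ... | no _  = suc i

  prev : ℕ → ℕ
  prev zero    = n ∸ 1
  prev (suc j) = j

  private
    0<n : 0 < n
    0<n = ≤-trans (s≤s z≤n) 3≤n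

    1+[n∸1]≡n : suc (n ∸ 1) ≡ n
    1+[n∸1]≡n = trans (+-comm 1 (n ∸ 1)) (m∸n+n≡m 0<n)

  next<n : ∀ {i} → i < n → next i < n
  next<n {i} i<n with suc i ≟ n
  ... | yes _   = 0<n
  ... | no 1+i≢n = ≤∧≢⇒< i<n 1+i≢n

  prev<n : ∀ {j} → j < n → prev j < n
  prev<n {zero}  _   = subst (n ∸ 1 <_) 1+[n∸1]≡n ≤-refl
  prev<n {suc j} j<n = <-trans (n<1+n j) j<n

  next≡⇔≡prev : ∀ {i j} → j < n → j ≡ next i ⇔ i ≡ prev j
  next≡⇔≡prev {i} {j} j<n = mk⇔ to′ (from′ j<n)
    where
    to′ : j ≡ next i → i ≡ prev j
    to′ j≡next with suc i ≟ n
    to′ refl | yes 1+i≡n = suc-injective (trans 1+i≡n (sym 1+[n∸1]≡n))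
    to′ refl | no _      = refl
    from′ : ∀ {j} → j < n → i ≡ prev j → j ≡ next i
    from′ {zero} _ i≡prev with suc i ≟ n
    ... | yes _    = refl
    ... | no 1+i≢n = ⊥-elim (1+i≢n (trans (cong suc i≡prev) 1+[n∸1]≡n))
    from′ {suc j} j<n refl with suc j ≟ n
    ... | yes 1+j≡n = ⊥-elim (<⇒≢ j<n 1+j≡n)
    ... | no _      = refl

  next≢ : ∀ i → i ≢ next i
  next≢ i i≡next with suc i ≟ n
  next≢ i refl | yes 1+i≡n = <⇒≢ (≤-trans (s≤s (s≤s z≤n)) 3≤n) 1+i≡n
  next≢ i i≡next | no _    = m≢1+m+n i (trans i≡next (cong suc (sym (+-identityʳ i))))

  next²≢ : ∀ i → i ≢ next (next i)
  next²≢ i i≡next² with suc i ≟ n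
  next²≢ i i≡next² | yes 1+i≡n with 1 ≟ n
  ... | yes 1≡n = <⇒≢ (≤-trans (s≤s (s≤s z≤n)) 3≤n) 1≡n
  next²≢ _ refl | yes 2≡n | no _ = <⇒≢ 3≤n 2≡n
  next²≢ i i≡next² | no _ with suc (suc i) ≟ n
  next²≢ _ refl | no _ | yes 2≡n = <⇒≢ (≤-trans (s≤s (s≤s (s≤s z≤n))) 3≤n) 2≡n
  next²≢ i i≡next² | no _ | no _ = m≢1+m+n i (trans i≡next² (cong suc (+-comm 1 i)))

  cyclicArray : ∀ {X : Set} (a b c : ℕ → X) → ℕ → ℕ → Maybe X
  cyclicArray a b c i j with j ≟ i | j ≟ next i | j ≟ next (next i)
  ... | yes _ | _     | _     = just (a i)
  ... | no _  | yes _ | _     = just (b i)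
  ... | no _  | no _  | yes _ = just (c i)
  ... | no _  | no _  | no _  = nothing

  module _ {X : Set} (φ : Maybe X → ℕ) (φ-nothing : φ nothing ≡ 0) (a b c : ℕ → X) where

    cyclicArray-weight : ∀ i j → φ (cyclicArray a b c i j) ≡
      χ (j ≟ i) * φ (just (a i)) + χ (j ≟ next i) * φ (just (b i)) + χ (j ≟ next (next i)) * φ (just (c i))
    cyclicArray-weight i j with j ≟ i | j ≟ next i | j ≟ next (next i)
    ... | yes refl | yes j≡next  | _           = ⊥-elim (next≢ j j≡next)
    ... | yes refl | no _        | yes j≡next² = ⊥-elim (next²≢ j j≡next²)
    ... | yes _    | no _        | no _        = first (φ (just (a i))) (φ (just (b i))) (φ (just (c i)))
      where
      first : ∀ x y z → x ≡ 1 * x + 0 * y + 0 * z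
      first = solve-∀
    ... | no _     | yes refl    | yes j≡next² = ⊥-elim (next≢ (next i) j≡next²)
    ... | no _     | yes _       | no _        = second (φ (just (a i))) (φ (just (b i))) (φ (just (c i)))
      where
      second : ∀ x y z → y ≡ 0 * x + 1 * y + 0 * z
      second = solve-∀
    ... | no _     | no _        | yes _       = third (φ (just (a i))) (φ (just (b i))) (φ (just (c i)))
      where
      third : ∀ x y z → z ≡ 0 * x + 0 * y + 1 * z
      third = solve-∀
    ... | no _     | no _        | no _        = φ-nothing

    private
      sum-three : ∀ (f g h : ℕ → ℕ) → ∑[ k < n ] (f k + g k + h k) ≡ sum n f + sum n g + sum n h
      sum-three f g h = trans (sum-distrib-+ n (λ k → f k + g k) h) (cong (_+ sum n h) (sum-distrib-+ n f g))

      ≡-sym⇔ : ∀ {x y : ℕ} → x ≡ y ⇔ y ≡ x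
      ≡-sym⇔ = mk⇔ sym sym

    row-sum : ∀ {i} → i < n →
              ∑[ j < n ] φ (cyclicArray a b c i j) ≡ φ (just (a i)) + φ (just (b i)) + φ (just (c i))
    row-sum {i} i<n = begin
      ∑[ j < n ] φ (cyclicArray a b c i j)
        ≡⟨ sum-cong n (λ j _ → cyclicArray-weight i j) ⟩
      ∑[ j < n ] (χ (j ≟ i) * φ (just (a i)) + χ (j ≟ next i) * φ (just (b i))
                  + χ (j ≟ next (next i)) * φ (just (c i)))
        ≡⟨ sum-three _ _ _ ⟩
      _ ≡⟨ cong₂ _+_ (cong₂ _+_ (sum-select n (_≟ i) _ i<n (λ _ _ → ⇔-id _))
                                (sum-select n (_≟ next i) _ (next<n i<n) (λ _ _ → ⇔-id _)))
                     (sum-select n (_≟ next (next i)) _ (next<n (next<n i<n)) (λ _ _ → ⇔-id _)) ⟩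
      φ (just (a i)) + φ (just (b i)) + φ (just (c i)) ∎
      where open ≡-Reasoning

    column-sum : ∀ {j} → j < n →
                 ∑[ i < n ] φ (cyclicArray a b c i j)
                   ≡ φ (just (a j)) + φ (just (b (prev j))) + φ (just (c (prev (prev j))))
    column-sum {j} j<n = begin
      ∑[ i < n ] φ (cyclicArray a b c i j)
        ≡⟨ sum-cong n (λ i _ → cyclicArray-weight i j) ⟩
      ∑[ i < n ] (χ (j ≟ i) * φ (just (a i)) + χ (j ≟ next i) * φ (just (b i))
                  + χ (j ≟ next (next i)) * φ (just (c i)))
        ≡⟨ sum-three _ _ _ ⟩
      _ ≡⟨ cong₂ _+_ (cong₂ _+_ (sum-select n (j ≟_) _ j<n (λ _ _ → ≡-sym⇔))
                                (sum-select n (λ i → j ≟ next i) _ (prev<n j<n) (λ _ _ → next≡⇔≡prev j<n)))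
                     (sum-select n (λ i → j ≟ next (next i)) _ (prev<n (prev<n j<n))
                       (λ _ _ → next≡⇔≡prev (prev<n j<n) ⇔-∘ (≡-sym⇔ ⇔-∘ next≡⇔≡prev j<n))) ⟩
      φ (just (a j)) + φ (just (b (prev j))) + φ (just (c (prev (prev j)))) ∎
      where open ≡-Reasoning

-- The construction

module Construction (n lam τ : ℕ) .{{_ : NonZero τ}} (3≤n : 3 ≤ n) (lamτ≡2n : lam * τ ≡ 2 * n) where

  open Cycle n 3≤n

  w : ℕ
  w = 4 * τ

  instance
    w-nonZero : NonZero w
    w-nonZero = m*n≢0 4 τ

  entry₀ entry₁ entry₂ : ℕ → ℕ
  entry₀ i = 1 + 8 * i
  entry₁ i = 10 + 16 * (n ∸ suc i)
  entry₂ i = 5 + 8 * i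

  array : ℕ → ℕ → Maybe (Fin w)
  array = cyclicArray (λ i → entry₀ i mod w) (λ i → entry₁ i mod w) (λ i → entry₂ i mod w)

  row-entries : ∀ {i} → i < n → 8 * n ∣ entry₀ i + entry₁ i + entry₂ i
  row-entries {i} i<n = divides 2 (begin
    entry₀ i + entry₁ i + entry₂ i ≡⟨ lemma i (n ∸ suc i) ⟩
    2 * (8 * (suc i + (n ∸ suc i))) ≡⟨ cong (λ k → 2 * (8 * k)) (m+[n∸m]≡n i<n) ⟩
    2 * (8 * n) ∎)
    where
    open ≡-Reasoning
    lemma : ∀ i d → 1 + 8 * i + (10 + 16 * d) + (5 + 8 * i) ≡ 2 * (8 * (suc i + d))
    lemma = solve-∀

  column-entries : ∀ {j} → j < n → 8 * n ∣ entry₀ j + entry₁ (prev j) + entry₂ (prev (prev j))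
  column-entries {zero} _ = divides 1 (trans (cong (λ k → entry₀ 0 + entry₁ (n ∸ 1) + entry₂ (prev k)) n∸1≡2+[n∸3])
                                             (first-column n 3≤n))
    where
    n∸1≡2+[n∸3] : n ∸ 1 ≡ 2 + (n ∸ 3)
    n∸1≡2+[n∸3] = lemma n 3≤n
      where
      lemma : ∀ N → 3 ≤ N → N ∸ 1 ≡ 2 + (N ∸ 3)
      lemma (suc (suc (suc _))) (s≤s (s≤s (s≤s _))) = refl
    first-column : ∀ N → 3 ≤ N → 1 + 8 * 0 + (10 + 16 * (N ∸ suc (N ∸ 1))) + (5 + 8 * (1 + (N ∸ 3))) ≡ 1 * (8 * N)
    first-column (suc (suc (suc m))) (s≤s (s≤s (s≤s _))) rewrite n∸n≡0 m = lemma m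
      where
      lemma : ∀ m → 1 + 8 * 0 + (10 + 16 * 0) + (5 + 8 * (1 + m)) ≡ 1 * (8 * (3 + m))
      lemma = solve-∀
  column-entries {suc zero} _ = divides 3 (second-column n 3≤n)
    where
    second-column : ∀ N → 3 ≤ N → 1 + 8 * 1 + (10 + 16 * (N ∸ 1)) + (5 + 8 * (N ∸ 1)) ≡ 3 * (8 * N)
    second-column (suc (suc (suc m))) (s≤s (s≤s (s≤s _))) = lemma m
      where
      lemma : ∀ m → 1 + 8 * 1 + (10 + 16 * (2 + m)) + (5 + 8 * (2 + m)) ≡ 3 * (8 * (3 + m))
      lemma = solve-∀
  column-entries {suc (suc j)} 2+j<n = divides 2 (begin
    entry₀ (2 + j) + entry₁ (1 + j) + entry₂ j ≡⟨ lemma j (n ∸ (2 + j)) ⟩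
    2 * (8 * (2 + j + (n ∸ (2 + j))))          ≡⟨ cong (λ k → 2 * (8 * k)) (m+[n∸m]≡n (<⇒≤ 2+j<n)) ⟩
    2 * (8 * n) ∎)
    where
    open ≡-Reasoning
    lemma : ∀ j d → 1 + 8 * (2 + j) + (10 + 16 * d) + (5 + 8 * j) ≡ 2 * (8 * (2 + j + d))
    lemma = solve-∀

  w∣8n : w ∣ 8 * n
  w∣8n = divides lam (begin
    8 * n         ≡⟨ *-assoc 4 2 n ⟩
    4 * (2 * n)   ≡⟨ cong (4 *_) lamτ≡2n ⟨
    4 * (lam * τ) ≡⟨ x∙yz≈y∙xz 4 lam τ ⟩
    lam * w       ∎)
    where open ≡-Reasoning

  toℕ-mod : ∀ x → toℕ (x mod w) ≡ x % w
  toℕ-mod x = toℕ-fromℕ< (m%n<n x w)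

  hits : ℕ → Maybe (Fin w) → ℕ
  hits z nothing  = 0
  hits z (just x) = [ w ∣ toℕ x + z ]

  hits-entry : ∀ x z → hits z (just (x mod w)) ≡ [ w ∣ x + z ]
  hits-entry x z = trans (cong (λ r → [ w ∣ r + z ]) (toℕ-mod x)) ([∣]-mod w x z)

  occ≡hits : ∀ y cell → occ y cell ≡ hits (w ∸ toℕ y) cell + hits (toℕ y) cell
  occ≡hits y nothing  = refl
  occ≡hits y (just x) = cong (_+ [ w ∣ toℕ x + toℕ y ])
    (χ-cong (≡⇔∣+∸ (toℕ<n x) (toℕ<n y) ⇔-∘ mk⇔ (cong toℕ) toℕ-injective) (x ≟ᶠ y) (w ∣? _))

  ∣-complement : ∀ {d y} a b → y ≤ w → d ∣ a + b + w → d ∣ a + (w ∸ y) + (b + y)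
  ∣-complement {d} {y} a b y≤w = subst (d ∣_) (begin
    a + b + w           ≡⟨ cong (a + b +_) (m∸n+n≡m y≤w) ⟨
    a + b + (w ∸ y + y) ≡⟨ lemma a b (w ∸ y) y ⟩
    a + (w ∸ y) + (b + y) ∎)
    where
    open ≡-Reasoning
    lemma : ∀ a b c y → a + b + (c + y) ≡ a + c + (b + y)
    lemma = solve-∀

  first-family : ∀ z → ∑[ t < 2 * n ] [ w ∣ 1 + 4 * t + z ] ≡ lam * [ 4 ∣ 1 + z ]
  first-family z = begin
    ∑[ t < 2 * n ] [ w ∣ 1 + 4 * t + z ]             ≡⟨ cong (λ k → ∑[ t < k ] [ w ∣ 1 + 4 * t + z ]) lamτ≡2n ⟨
    ∑[ t < lam * τ ] [ w ∣ 1 + 4 * t + z ]           ≡⟨ sum-cong (lam * τ) (λ t _ → cong [ w ∣_] (lemma t z)) ⟩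
    ∑[ t < lam * τ ] [ w ∣ 4 * (1 * t) + (1 + z) ]   ≡⟨ count-multiples lam 4 τ (1 + z) (1-unitMod τ) ⟩
    lam * [ 4 ∣ 1 + z ]                              ∎
    where
    open ≡-Reasoning
    lemma : ∀ t z → 1 + 4 * t + z ≡ 4 * (1 * t) + (1 + z)
    lemma = solve-∀

  second-family : Factorisation n lam τ → ∀ {y} → y ≤ w →
    ∑[ k < n ] [ w ∣ 10 + 16 * k + (w ∸ y) ] + ∑[ k < n ] [ w ∣ 10 + 16 * k + y ] ≡ lam * [ 4 ∣ 2 + y ]
  second-family (lam-even l q lam≡2l τ≡1+2q n≡lτ) {y} y≤w = begin
    count (w ∸ y) + count y                       ≡⟨ cong₂ _+_ (period-τ (w ∸ y)) (period-τ y) ⟩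
    l * [ 4 ∣ 10 + (w ∸ y) ] + l * [ 4 ∣ 10 + y ] ≡⟨ cong₂ (λ a b → l * a + l * b) ([∣]-complement (∣-complement 10 2 y≤w (∣m∣n⇒∣m+n (divides 3 refl) (m∣m*n τ)))) ([∣]-shift 4 2 (2 + y)) ⟩
    l * [ 4 ∣ 2 + y ] + l * [ 4 ∣ 2 + y ]         ≡⟨ lemma l _ ⟩
    (2 * l) * [ 4 ∣ 2 + y ]                       ≡⟨ cong (_* [ 4 ∣ 2 + y ]) lam≡2l ⟨
    lam * [ 4 ∣ 2 + y ]                           ∎
    where
    open ≡-Reasoning
    count : ℕ → ℕ
    count z = ∑[ k < n ] [ w ∣ 10 + 16 * k + z ]
    lemma : ∀ l x → l * x + l * x ≡ (2 * l) * x
    lemma = solve-∀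
    period-τ : ∀ z → count z ≡ l * [ 4 ∣ 10 + z ]
    period-τ z = begin
      count z                                         ≡⟨ cong (λ k → ∑[ k′ < k ] [ w ∣ 10 + 16 * k′ + z ]) n≡lτ ⟩
      ∑[ k < l * τ ] [ w ∣ 10 + 16 * k + z ]          ≡⟨ sum-cong (l * τ) (λ k _ → cong [ w ∣_] (lemma′ k z)) ⟩
      ∑[ k < l * τ ] [ w ∣ 4 * (4 * k) + (10 + z) ]   ≡⟨ count-multiples l 4 τ (10 + z) (subst (λ m → UnitMod m 4) (sym τ≡1+2q) (4-unitMod q)) ⟩
      l * [ 4 ∣ 10 + z ]                              ∎
      where
      lemma′ : ∀ k z → 10 + 16 * k + z ≡ 4 * (4 * k) + (10 + z)
      lemma′ = solve-∀
  second-family (lam-odd p q τ≡2p p≡1+2q n≡lam*p) {y} y≤w = begin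
    count (w ∸ y) + count y                           ≡⟨ cong₂ _+_ (period-p (w ∸ y)) (period-p y) ⟩
    lam * [ 8 ∣ 10 + (w ∸ y) ] + lam * [ 8 ∣ 10 + y ] ≡⟨ cong₂ (λ a b → lam * a + lam * b)
                                                           ([∣]-complement (∣-complement 10 6 y≤w 8∣16+w))
                                                           ([∣]-shift 8 1 (2 + y)) ⟩
    lam * [ 8 ∣ 6 + y ] + lam * [ 8 ∣ 2 + y ]         ≡⟨ lemma lam [ 8 ∣ 6 + y ] [ 8 ∣ 2 + y ] ⟩
    lam * ([ 8 ∣ 2 + y ] + [ 8 ∣ 6 + y ])             ≡⟨ cong (lam *_) ([8∣]-split (2 + y)) ⟩
    lam * [ 4 ∣ 2 + y ]                               ∎
    where
    open ≡-Reasoning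
    instance
      p-nonZero : NonZero p
      p-nonZero = subst NonZero (sym p≡1+2q) _
    w≡8p : w ≡ 8 * p
    w≡8p = trans (cong (4 *_) τ≡2p) (sym (*-assoc 4 2 p))
    8∣16+w : 8 ∣ 10 + 6 + w
    8∣16+w = ∣m∣n⇒∣m+n (divides 2 refl) (subst (8 ∣_) (sym w≡8p) (m∣m*n p))
    count : ℕ → ℕ
    count z = ∑[ k < n ] [ w ∣ 10 + 16 * k + z ]
    lemma : ∀ l a b → l * a + l * b ≡ l * (b + a)
    lemma = solve-∀
    period-p : ∀ z → count z ≡ lam * [ 8 ∣ 10 + z ]
    period-p z = begin
      count z                                           ≡⟨ cong (λ k → ∑[ k′ < k ] [ w ∣ 10 + 16 * k′ + z ]) n≡lam*p ⟩
      ∑[ k < lam * p ] [ w ∣ 10 + 16 * k + z ]          ≡⟨ sum-cong (lam * p) (λ k _ → cong₂ [_∣_] w≡8p (lemma′ k z)) ⟩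
      ∑[ k < lam * p ] [ 8 * p ∣ 8 * (2 * k) + (10 + z) ] ≡⟨ count-multiples lam 8 p (10 + z) (subst (λ m → UnitMod m 2) (sym p≡1+2q) (2-unitMod q)) ⟩
      lam * [ 8 ∣ 10 + z ]                              ∎
      where
      lemma′ : ∀ k z → 10 + 16 * k + z ≡ 8 * (2 * k) + (10 + z)
      lemma′ = solve-∀

  hits-total : ∀ z → ∑[ i < n ] ∑[ j < n ] hits z (array i j)
                     ≡ lam * [ 4 ∣ 1 + z ] + ∑[ k < n ] [ w ∣ 10 + 16 * k + z ]
  hits-total z = begin
    ∑[ i < n ] ∑[ j < n ] hits z (array i j)
      ≡⟨ sum-cong n (λ i i<n → row-sum (hits z) refl _ _ _ i<n) ⟩
    ∑[ i < n ] (hits z (just (entry₀ i mod w)) + hits z (just (entry₁ i mod w)) + hits z (just (entry₂ i mod w)))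
      ≡⟨ sum-cong n (λ i _ → cong₂ _+_ (cong₂ _+_ (hits-entry (entry₀ i) z) (hits-entry (entry₁ i) z)) (hits-entry (entry₂ i) z)) ⟩
    ∑[ i < n ] ([ w ∣ entry₀ i + z ] + [ w ∣ entry₁ i + z ] + [ w ∣ entry₂ i + z ])
      ≡⟨ sum-cong n (λ i _ → regroup i) ⟩
    ∑[ i < n ] (first (2 * i) + first (1 + 2 * i) + second (n ∸ suc i))
      ≡⟨ sum-distrib-+ n _ _ ⟩
    ∑[ i < n ] (first (2 * i) + first (1 + 2 * i)) + ∑[ i < n ] second (n ∸ suc i)
      ≡⟨ cong₂ _+_ (trans (sum-interleave n first) (first-family z)) (sum-reverse n second) ⟩
    lam * [ 4 ∣ 1 + z ] + ∑[ k < n ] second k ∎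
    where
    open ≡-Reasoning
    first second : ℕ → ℕ
    first t  = [ w ∣ 1 + 4 * t + z ]
    second k = [ w ∣ 10 + 16 * k + z ]
    regroup : ∀ i → [ w ∣ entry₀ i + z ] + [ w ∣ entry₁ i + z ] + [ w ∣ entry₂ i + z ]
                    ≡ first (2 * i) + first (1 + 2 * i) + second (n ∸ suc i)
    regroup i = trans (lemma [ w ∣ entry₀ i + z ] [ w ∣ entry₁ i + z ] [ w ∣ entry₂ i + z ])
                      (cong₂ (λ a b → a + b + second (n ∸ suc i)) (cong [ w ∣_] (lemma₀ i z)) (cong [ w ∣_] (lemma₂ i z)))
      where
      lemma : ∀ a b c → a + b + c ≡ a + c + b
      lemma = solve-∀
      lemma₀ : ∀ i z → 1 + 8 * i + z ≡ 1 + 4 * (2 * i) + z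
      lemma₀ = solve-∀
      lemma₂ : ∀ i z → 5 + 8 * i + z ≡ 1 + 4 * (1 + 2 * i) + z
      lemma₂ = solve-∀

  occurrences : Factorisation n lam τ → ∀ (y : Fin w) → ∑[ i < n ] ∑[ j < n ] occ y (array i j)
                ≡ lam * ([ 4 ∣ 1 + toℕ y ] + [ 4 ∣ 2 + toℕ y ] + [ 4 ∣ 3 + toℕ y ])
  occurrences fact y = begin
    ∑[ i < n ] ∑[ j < n ] occ y (array i j)
      ≡⟨ sum-cong n (λ i _ → trans (sum-cong n (λ j _ → occ≡hits y (array i j))) (sum-distrib-+ n _ _)) ⟩
    ∑[ i < n ] (∑[ j < n ] hits (w ∸ y′) (array i j) + ∑[ j < n ] hits y′ (array i j))
      ≡⟨ sum-distrib-+ n _ _ ⟩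
    ∑[ i < n ] ∑[ j < n ] hits (w ∸ y′) (array i j) + ∑[ i < n ] ∑[ j < n ] hits y′ (array i j)
      ≡⟨ cong₂ _+_ (hits-total (w ∸ y′)) (hits-total y′) ⟩
    lam * [ 4 ∣ 1 + (w ∸ y′) ] + second (w ∸ y′) + (lam * [ 4 ∣ 1 + y′ ] + second y′)
      ≡⟨ lemma (lam * [ 4 ∣ 1 + (w ∸ y′) ]) (second (w ∸ y′)) (lam * [ 4 ∣ 1 + y′ ]) (second y′) ⟩
    lam * [ 4 ∣ 1 + (w ∸ y′) ] + lam * [ 4 ∣ 1 + y′ ] + (second (w ∸ y′) + second y′)
      ≡⟨ cong₂ (λ a b → lam * a + lam * [ 4 ∣ 1 + y′ ] + b)
               ([∣]-complement (∣-complement 1 3 y′≤w (∣m∣n⇒∣m+n (divides 1 refl) (m∣m*n τ))))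
               (second-family fact y′≤w) ⟩
    lam * [ 4 ∣ 3 + y′ ] + lam * [ 4 ∣ 1 + y′ ] + lam * [ 4 ∣ 2 + y′ ]
      ≡⟨ lemma′ lam [ 4 ∣ 1 + y′ ] [ 4 ∣ 2 + y′ ] [ 4 ∣ 3 + y′ ] ⟩
    lam * ([ 4 ∣ 1 + y′ ] + [ 4 ∣ 2 + y′ ] + [ 4 ∣ 3 + y′ ]) ∎
    where
    open ≡-Reasoning
    y′ : ℕ
    y′ = toℕ y
    y′≤w : y′ ≤ w
    y′≤w = <⇒≤ (toℕ<n y)
    second : ℕ → ℕ
    second z = ∑[ k < n ] [ w ∣ 10 + 16 * k + z ]
    lemma : ∀ a b c d → a + b + (c + d) ≡ a + c + (b + d)
    lemma = solve-∀
    lemma′ : ∀ l a b c → l * c + l * a + l * b ≡ l * (a + b + c)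
    lemma′ = solve-∀

  InJ⇔4∣ : ∀ y → InJ w τ y ⇔ 4 ∣ toℕ y
  InJ⇔4∣ y = mk⇔ (λ w∣τy → *-cancelʳ-∣ τ (subst (w ∣_) (*-comm τ (toℕ y)) w∣τy))
                 (λ 4∣y → subst (w ∣_) (*-comm (toℕ y) τ) (*-monoˡ-∣ τ 4∣y))

  residues-sum : ∀ {a b c} → 8 * n ∣ a + b + c →
                 w ∣ val (just (a mod w)) + val (just (b mod w)) + val (just (c mod w))
  residues-sum {a} {b} {c} 8n∣a+b+c = subst (w ∣_) (sym (cong₂ _+_ (cong₂ _+_ (toℕ-mod a) (toℕ-mod b)) (toℕ-mod c)))
                                            (∣-sum-of-residues w a b c (∣-trans w∣8n 8n∣a+b+c))

  A : PFArray n w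
  A i j = array (toℕ i) (toℕ j)

  A-isH : Factorisation n lam τ → IsH lam τ n 3 w A
  A-isH fact = record
    { rowFilled = λ i → trans (Σ-Fin-toℕ n (λ j → filled (array (toℕ i) j))) (row-sum filled refl _ _ _ (toℕ<n i))
    ; colFilled = λ j → trans (Σ-Fin-toℕ n (λ i → filled (array i (toℕ j)))) (column-sum filled refl _ _ _ (toℕ<n j))
    ; outsideJ  = λ y y∉J → trans (count y)
        (trans (cong (lam *_) (nonzero-residues-of-non-multiple (λ 4∣y → y∉J (from (InJ⇔4∣ y) 4∣y)))) (*-identityʳ lam))
    ; insideJ   = λ y y∈J → trans (count y)
        (trans (cong (lam *_) (nonzero-residues-of-multiple (to (InJ⇔4∣ y) y∈J))) (*-zeroʳ lam))
    ; rowSum    = λ i → subst (w ∣_) (sym (trans (Σ-Fin-toℕ n (λ j → val (array (toℕ i) j))) (row-sum val refl _ _ _ (toℕ<n i))))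
                                 (residues-sum (row-entries (toℕ<n i)))
    ; colSum    = λ j → subst (w ∣_) (sym (trans (Σ-Fin-toℕ n (λ i → val (array i (toℕ j)))) (column-sum val refl _ _ _ (toℕ<n j))))
                                 (residues-sum (column-entries (toℕ<n j)))
    }
    where
    count : ∀ y → Σ-Fin n (λ i → Σ-Fin n (λ j → occ y (A i j)))
                  ≡ lam * ([ 4 ∣ 1 + toℕ y ] + [ 4 ∣ 2 + toℕ y ] + [ 4 ∣ 3 + toℕ y ])
    count y = trans (Σ-Fin²-toℕ n (λ i j → occ y (array i j))) (occurrences fact y)

proposition4p15 : ∀ (n lam : ℕ) .{{_ : NonZero lam}} → (∃ λ k → n ≡ 2 * k + 1) → 3 ≤ n →
                  lam ∣ 2 * n → HExists lam ((2 * n) / lam) n 3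
proposition4p15 n lam (k , n≡2k+1) 3≤n lam∣2n =
  subst (λ w → Σ (PFArray n w) (IsH lam τ n 3 w)) (sym w≡4τ) (A , A-isH (factorisation {k = k} n≡2k+1 lamτ≡2n))
  where
  τ : ℕ
  τ = (2 * n) / lam
  lamτ≡2n : lam * τ ≡ 2 * n
  lamτ≡2n = m*[n/m]≡n lam∣2n
  instance
    τ-nonZero : NonZero τ
    τ-nonZero = ≢-nonZero λ τ≡0 →
      contradiction (subst (3 ≤_) (halve {y = 0} (trans (sym lamτ≡2n) (trans (cong (lam *_) τ≡0) (*-zeroʳ lam)))) 3≤n) λ ()
  w≡4τ : wOf lam τ n ≡ 4 * τ
  w≡4τ = trans (cong (_+ τ) (trans (cong (_/ lam) (*-assoc 3 2 n)) (*-/-assoc 3 lam∣2n))) (+-comm (3 * τ) τ)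
  open Construction n lam τ 3≤n lamτ≡2n
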